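{- Let $n\ge1$ and $x,y$ coprime with $1\le x<y$. For $c\in L^n_a$ let $\phi(c)$ be the stable decomposition of $h_E(c)$. Then $\phi$ is a bijection from $L^n_a$ onto $L^n_d$, and $h_E(\phi(c))=h_E(c)$ for all $c\in L^n_a$.
   Context: Let $d_k=x^{n-k}y^k$ for $0\le k\le n+1$, and for a word $c=(c_0,\dots,c_{n+1})\in\mathbb{Z}^{n+2}$ let $h_E(c)=\sum_{k=0}^{n+1}c_kd_k$. The stable decomposition of an integer $v\ge0$ is the unique word $(c_0,\dots,c_{n+1})$ with $h_E(c)=v$, $c_k\in\{0,\dots,y-1\}$ for $0\le k\le n$ and $c_{n+1}\in x\mathbb{Z}$ (equivalently, the stabilization of any nonnegative chip configuration with $h_E$-value $v$ in the Engel machine where each $u_k$, $0\le k\le n$, has $x$ arcs to $u_{k+1}$ and $y-x$ arcs to an extra sink). Languages are over the alphabet $\mathbb{Z}$, a set in a regular expression denoting any single letter from it: $L_a$ is described by $\{1,\dots,y\}^*\cdot0\cdot\{0,\dots,x-1\}^*\cdot0$ and $L_d$ by $\{0,\dots,y-1\}^*\cdot0\cdot\{1,\dots,x\}^*\cdot0$; $L^n_a,L^n_d$ are their subsets of words of length $n+2$. -}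

module Defs where

open import Data.Nat as ℕ using (ℕ; zero; suc; _∸_; _^_)
open import Data.Integer as ℤ using (ℤ; +_; _+_; _*_; _≤_; _<_)
open import Data.Integer.Divisibility using (_∣_)
open import Data.List using (List; []; _∷_; _++_; length)
open import Data.List.Relation.Unary.All using (All)
open import Data.Product using (Σ; _×_; ∃; ∃-syntax)
open import Relation.Binary.PropositionalEquality using (_≡_)

Word : Set
Word = List ℤ

-- Since d_{n+1} = y^{n+1}/x is not an integer we work with the integer-valued
-- x·h_E(c) = Σ_k c_k x^{n+1-k} y^k  (x ≥ 1, so nothing is lost).
xhE-from : (n x y k : ℕ) → Word → ℤ
xhE-from n x y k []       = + 0
xhE-from n x y k (a ∷ as) = a * + (x ^ (suc n ∸ k) ℕ.* y ^ k) + xhE-from n x y (suc k) as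

xhE : (n x y : ℕ) → Word → ℤ
xhE n x y c = xhE-from n x y 0 c

HE≡ : (n x y : ℕ) → Word → ℤ → Set
HE≡ n x y c v = xhE n x y c ≡ + x * v

IsStableDecomposition : (n x y : ℕ) → ℤ → Word → Set
IsStableDecomposition n x y v d =
  (+ 0 ≤ v) × HE≡ n x y d v ×
  Σ Word λ u → Σ ℤ λ t →
    (d ≡ u ++ (t ∷ [])) × (length u ≡ suc n) ×
    All (λ a → (+ 0 ≤ a) × (a < + y)) u × ((+ x) ∣ t)

IsPhi : (n x y : ℕ) → Word → Word → Set
IsPhi n x y c d = Σ ℤ λ v → HE≡ n x y c v × IsStableDecomposition n x y v d

La : (x y : ℕ) → Word → Set
La x y c = Σ Word λ u → Σ Word λ w →
  (c ≡ u ++ (+ 0 ∷ (w ++ (+ 0 ∷ [])))) ×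
  All (λ a → (+ 1 ≤ a) × (a ≤ + y)) u ×
  All (λ a → (+ 0 ≤ a) × (a ≤ + (x ∸ 1))) w

Ld : (x y : ℕ) → Word → Set
Ld x y c = Σ Word λ u → Σ Word λ w →
  (c ≡ u ++ (+ 0 ∷ (w ++ (+ 0 ∷ [])))) ×
  All (λ a → (+ 0 ≤ a) × (a ≤ + (y ∸ 1))) u ×
  All (λ a → (+ 1 ≤ a) × (a ≤ + x)) w

Lan : (n x y : ℕ) → Word → Set
Lan n x y c = La x y c × (length c ≡ suc (suc n))

Ldn : (n x y : ℕ) → Word → Set
Ldn n x y c = Ld x y c × (length c ≡ suc (suc n))

{-# OPTIONS --safe #-}
module Submission where

-- Stabilising a word c ∈ L_a needs a single left-to-right pass of the Engel machine:
-- the letters of c are at most y, so every vertex fires at most once and the chips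
-- passed on form a single carry bit.  Firing preserves h_E because y d_k = x d_{k+1}.
-- The pass maps L_a into L_d, and it can be run backwards: an output letter equal to
-- the incoming carry comes either from a 0, followed by a copied tail in {0,…,x−1}*·0,
-- or from a fired y, and the two are told apart because a carry entering a word of
-- L_a is always deposited as a letter ≥ x.
-- Finally the stable decomposition is unique because x and y are coprime: two
-- decompositions of the same value agree modulo y in their first digit, and so on.

open import Defs

module Stabilisation where
  open import Data.Bool using (Bool; true; false)
  open import Data.Empty using (⊥-elim)
  open import Data.Integer as ℤ
    using (ℤ; +_; 0ℤ; 1ℤ; _+_; _-_; -_; _*_; _≤_; _<_; +≤+; +<+; ∣_∣)
  import Data.Integer.Properties as ℤ
  open import Data.Integer.Properties using (_≤?_; _<?_; _≟_)
  open import Algebra.Properties.AbelianGroup ℤ.+-0-abelianGroup using (∙-cancelˡ; ∙-cancelʳ)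
  open import Data.Integer.Tactic.RingSolver using (solve-∀)
  open import Data.List using (List; []; _∷_; _++_; length)
  open import Data.List.Properties using (∷-injectiveˡ; ∷-injectiveʳ; ++-assoc; length-++)
  open import Data.List.Relation.Unary.All as All using (All; []; _∷_)
  open import Data.List.Relation.Unary.All.Properties using (All¬⇒¬Any; ++⁺)
  open import Data.List.Relation.Unary.Any using (Any; here; there)
  open import Data.Nat as ℕ using (ℕ; zero; suc; s≤s; z≤n; _^_)
  open import Data.Nat.Coprimality as Coprime using (Coprime)
  open import Data.Nat.Divisibility as ℕ using (divides)
  import Data.Nat.Properties as ℕ
  open import Data.Nat.Tactic.RingSolver using () renaming (solve-∀ to ℕ-solve-∀)
  open import Data.Product using (Σ; _×_; _,_; proj₁)
  open import Data.Sum using (_⊎_; inj₁; inj₂)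
  open import Function using (_∘_)
  open import Relation.Binary.Definitions using (tri<; tri≈; tri>)
  open import Relation.Binary.PropositionalEquality
  open import Relation.Nullary using (Dec; yes; no; ¬_)

  ≤-pred⇒< : ∀ {a m} → 1 ℕ.≤ m → 0ℤ ≤ a → a ≤ + (m ℕ.∸ 1) → a < + m
  ≤-pred⇒< {+ _} {suc _} _ _ (+≤+ a≤m-1) = +<+ (s≤s a≤m-1)

  <⇒≤-pred : ∀ {a m} → 0ℤ ≤ a → a < + m → a ≤ + (m ℕ.∸ 1)
  <⇒≤-pred {+ _} {suc _} _ (+<+ (s≤s a≤m-1)) = +≤+ a≤m-1

  1≤i⇒0≤i : ∀ {i} → 1ℤ ≤ i → 0ℤ ≤ i
  1≤i⇒0≤i = ℤ.≤-trans (+≤+ z≤n)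

  0≤i⇒i≡0⊎1≤i : ∀ {i} → 0ℤ ≤ i → i ≡ 0ℤ ⊎ 1ℤ ≤ i
  0≤i⇒i≡0⊎1≤i {+ 0}     _ = inj₁ refl
  0≤i⇒i≡0⊎1≤i {+ suc _} _ = inj₂ (+≤+ (s≤s z≤n))

  i+j-j≡i : ∀ i j → i + j - j ≡ i
  i+j-j≡i = solve-∀

  i-j+j≡i : ∀ i j → i - j + j ≡ i
  i-j+j≡i = solve-∀

  i+j-i≡j : ∀ i j → i + j - i ≡ j
  i+j-i≡j = solve-∀

  i<j⇒1≤j-i : ∀ {i j} → i < j → 1ℤ ≤ j - i
  i<j⇒1≤j-i {i} {j} i<j =
    subst (_≤ j - i) (i+j-j≡i 1ℤ i) (ℤ.+-monoˡ-≤ (- i) (ℤ.i<j⇒suc[i]≤j i<j))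

  i+k-j≤k : ∀ {i j} k → i ≤ j → i + k - j ≤ k
  i+k-j≤k {i} {j} k i≤j =
    subst (i + k - j ≤_) (i+j-i≡j j k) (ℤ.+-monoˡ-≤ (- j) (ℤ.+-monoˡ-≤ k i≤j))

  length-∷ʳ : ∀ {A : Set} (xs : List A) t → length (xs ++ t ∷ []) ≡ suc (length xs)
  length-∷ʳ xs t = trans (length-++ xs) (ℕ.+-comm (length xs) 1)

  ∣i-j∣<n : ∀ {i j n} → 0ℤ ≤ i → i < + n → 0ℤ ≤ j → j < + n → ∣ i - j ∣ ℕ.< n
  ∣i-j∣<n {+ p} {+ q} _ (+<+ p<n) _ (+<+ q<n) = ℕ.≤-<-trans ∣p-q∣≤p⊔q (ℕ.⊔-lub p<n q<n)
    where
    ∣p-q∣≤p⊔q : ∣ + p - + q ∣ ℕ.≤ p ℕ.⊔ q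
    ∣p-q∣≤p⊔q = subst (ℕ._≤ p ℕ.⊔ q) (cong ∣_∣ (sym (ℤ.m-n≡m⊖n p q))) (ℤ.∣m⊝n∣≤m⊔n p q)

  ∣∧<⇒≡0 : ∀ {d m} → d ℕ.∣ m → m ℕ.< d → m ≡ 0
  ∣∧<⇒≡0 {m = zero}  _   _   = refl
  ∣∧<⇒≡0 {m = suc _} d∣m m<d = ⊥-elim (ℕ.>⇒∤ m<d d∣m)

  coprime-divisor-^ : ∀ {x y} m {o} → Coprime y x → y ℕ.∣ x ^ m ℕ.* o → y ℕ.∣ o
  coprime-divisor-^ {y = y} zero {o} _ y∣o = subst (y ℕ.∣_) (ℕ.*-identityˡ o) y∣o
  coprime-divisor-^ {x} {y} (suc m) {o} coprime y∣x^[1+m]o = coprime-divisor-^ m coprime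
    (Coprime.coprime-divisor coprime (subst (y ℕ.∣_) (ℕ.*-assoc x (x ^ m) o) y∣x^[1+m]o))

  -- y divides (a − a′) x^m, and coprimality leaves |a − a′| < y no room but 0
  digit-cancel : ∀ {x y m a a′ f f′} → Coprime x y →
    0ℤ ≤ a → a < + y → 0ℤ ≤ a′ → a′ < + y →
    a * + (x ^ m) + + y * f ≡ a′ * + (x ^ m) + + y * f′ → a ≡ a′ × f ≡ f′
  digit-cancel {x} {y} {m} {a} {a′} {f} {f′} coprime 0≤a a<y 0≤a′ a′<y eq = a≡a′ , f≡f′
    where
    P : ℤ
    P = + (x ^ m)
    difference : (a - a′) * P ≡ + y * (f′ - f)
    difference = begin
      (a - a′) * P                              ≡⟨ split a a′ P (+ y) f ⟩
      (a * P + + y * f) - (a′ * P + + y * f)   ≡⟨ cong (_- (a′ * P + + y * f)) eq ⟩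
      (a′ * P + + y * f′) - (a′ * P + + y * f) ≡⟨ merge a′ P (+ y) f f′ ⟩
      + y * (f′ - f)                            ∎
      where
      open ≡-Reasoning
      split : ∀ a a′ P Y f → (a - a′) * P ≡ (a * P + Y * f) - (a′ * P + Y * f)
      split = solve-∀
      merge : ∀ a′ P Y f f′ → (a′ * P + Y * f′) - (a′ * P + Y * f) ≡ Y * (f′ - f)
      merge = solve-∀
    y∣x^m*∣a-a′∣ : y ℕ.∣ x ^ m ℕ.* ∣ a - a′ ∣
    y∣x^m*∣a-a′∣ = divides ∣ f′ - f ∣ (begin
      x ^ m ℕ.* ∣ a - a′ ∣ ≡⟨ ℕ.*-comm (x ^ m) _ ⟩
      ∣ a - a′ ∣ ℕ.* x ^ m ≡⟨ sym (ℤ.abs-* (a - a′) P) ⟩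
      ∣ (a - a′) * P ∣     ≡⟨ cong ∣_∣ difference ⟩
      ∣ + y * (f′ - f) ∣   ≡⟨ ℤ.abs-* (+ y) (f′ - f) ⟩
      y ℕ.* ∣ f′ - f ∣     ≡⟨ ℕ.*-comm y _ ⟩
      ∣ f′ - f ∣ ℕ.* y     ∎)
      where open ≡-Reasoning
    a≡a′ : a ≡ a′
    a≡a′ = ℤ.i-j≡0⇒i≡j a a′ (ℤ.∣i∣≡0⇒i≡0 (∣∧<⇒≡0
      (coprime-divisor-^ m (Coprime.sym coprime) y∣x^m*∣a-a′∣) (∣i-j∣<n 0≤a a<y 0≤a′ a′<y)))
    f≡f′ : f ≡ f′
    f≡f′ = ℤ.*-cancelˡ-≡ (+ y) f f′ {{ℤ.>-nonZero (ℤ.≤-<-trans 0≤a a<y)}}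
      (∙-cancelˡ (a * P) _ _ (trans eq (cong (λ b → b * P + + y * f′) (sym a≡a′))))

  module Carry (x y : ℕ) (1≤x : 1 ℕ.≤ x) (x<y : x ℕ.< y) where
    X Y : ℤ
    X = + x
    Y = + y

    0<X : 0ℤ < X
    0<X = +<+ 1≤x

    X<Y : X < Y
    X<Y = +<+ x<y

    0<Y : 0ℤ < Y
    0<Y = ℤ.<-trans 0<X X<Y

    1≤Y : 1ℤ ≤ Y
    1≤Y = ℤ.i<j⇒suc[i]≤j 0<Y

    1≤y : 1 ℕ.≤ y
    1≤y = ℕ.≤-trans 1≤x (ℕ.<⇒≤ x<y)

    _⊕_ : ℤ → Bool → ℤ
    a ⊕ false = a
    a ⊕ true  = a + X

    carry : Bool → ℤ
    carry b = 0ℤ ⊕ b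

    ⊕≡+carry : ∀ a b → a ⊕ b ≡ a + carry b
    ⊕≡+carry a false = sym (ℤ.+-identityʳ a)
    ⊕≡+carry a true  = refl

    ⊕-cancelʳ : ∀ {a a′} b → a ⊕ b ≡ a′ ⊕ b → a ≡ a′
    ⊕-cancelʳ false eq = eq
    ⊕-cancelʳ true  eq = ∙-cancelʳ X _ _ eq

    ⊕-sub : ∀ a b → a ⊕ b - Y ≡ (a - Y) ⊕ b
    ⊕-sub a false = refl
    ⊕-sub a true  = swap a X Y
      where
      swap : ∀ a X Y → a + X - Y ≡ a - Y + X
      swap = solve-∀

    carry<Y : ∀ b → carry b < Y
    carry<Y false = 0<Y
    carry<Y true  = X<Y

    X<a+X : ∀ {a} → 1ℤ ≤ a → X < a + X
    X<a+X 1≤a = ℤ.+-monoˡ-< X (ℤ.suc[i]≤j⇒i<j {0ℤ} 1≤a)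

    -- b records whether the current vertex has received x chips from the previous one
    φ : Bool → Word → Word
    φ b [] = []
    φ b (a ∷ r) with Y ≤? a ⊕ b
    ... | yes _ = a ⊕ b - Y ∷ φ true r
    ... | no  _ = a ⊕ b ∷ φ false r

    φ-fire : ∀ {a} b {r} → Y ≤ a ⊕ b → φ b (a ∷ r) ≡ a ⊕ b - Y ∷ φ true r
    φ-fire {a} b Y≤a⊕b with Y ≤? a ⊕ b
    ... | yes _     = refl
    ... | no Y≰a⊕b = ⊥-elim (Y≰a⊕b Y≤a⊕b)

    φ-hold : ∀ {a} b {r} → a ⊕ b < Y → φ b (a ∷ r) ≡ a ⊕ b ∷ φ false r
    φ-hold {a} b a⊕b<Y with Y ≤? a ⊕ b
    ... | yes Y≤a⊕b = ⊥-elim (ℤ.<⇒≱ a⊕b<Y Y≤a⊕b)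
    ... | no _      = refl

    φ-length : ∀ b r → length (φ b r) ≡ length r
    φ-length b [] = refl
    φ-length b (a ∷ r) with Y ≤? a ⊕ b
    ... | yes _ = cong suc (φ-length true r)
    ... | no _  = cong suc (φ-length false r)

    data LowTail : Word → Set where
      [0] : LowTail (0ℤ ∷ [])
      low : ∀ {a r} → 0ℤ ≤ a → a < X → LowTail r → LowTail (a ∷ r)

    data InLa : Word → Set where
      sep  : ∀ {r} → LowTail r → InLa (0ℤ ∷ r)
      high : ∀ {a r} → 1ℤ ≤ a → a ≤ Y → InLa r → InLa (a ∷ r)

    -- L_d = {0,…,y−1}* · 0 · {1,…,x}* · 0, and InLd⁰ r means 0 ∷ r ∈ L_d: after a 0,
    -- letters up to x may belong to the final block, while a letter in (x, y) needs a later 0.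
    data InLd⁰ : Word → Set
    data InLd : Word → Set where
      sep : ∀ {r} → InLd⁰ r → InLd (0ℤ ∷ r)
      mid : ∀ {a r} → 1ℤ ≤ a → a < Y → InLd r → InLd (a ∷ r)
    data InLd⁰ where
      [0] : InLd⁰ (0ℤ ∷ [])
      low : ∀ {a r} → 0ℤ ≤ a → a ≤ X → InLd⁰ r → InLd⁰ (a ∷ r)
      mid : ∀ {a r} → X < a → a < Y → InLd r → InLd⁰ (a ∷ r)

    lowTail? : (r : Word) → Dec (LowTail r)
    lowTail? [] = no λ ()
    lowTail? (a ∷ []) with a ≟ 0ℤ
    ... | yes refl = yes [0]
    ... | no a≢0   = no λ { [0] → a≢0 refl ; (low _ _ ()) }
    lowTail? (a ∷ r@(_ ∷ _)) with 0ℤ ≤? a | a <? X | lowTail? r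
    ... | yes 0≤a | yes a<X | yes w = yes (low 0≤a a<X w)
    ... | no 0≰a  | _       | _     = no λ { (low 0≤a _ _) → 0≰a 0≤a }
    ... | yes _   | no a≮X  | _     = no λ { (low _ a<X _) → a≮X a<X }
    ... | yes _   | yes _   | no ¬w = no λ { (low _ _ w) → ¬w w }

    LowTail⇒All<X : ∀ {r} → LowTail r → All (_< X) r
    LowTail⇒All<X [0]           = 0<X ∷ []
    LowTail⇒All<X (low _ a<X w) = a<X ∷ LowTail⇒All<X w

    LowTail⇒InLd⁰ : ∀ {r} → LowTail r → InLd⁰ r
    LowTail⇒InLd⁰ [0]             = [0]
    LowTail⇒InLd⁰ (low 0≤a a<X w) = low 0≤a (ℤ.<⇒≤ a<X) (LowTail⇒InLd⁰ w)

    InLd⇒InLd⁰ : ∀ {r} → InLd r → InLd⁰ r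
    InLd⇒InLd⁰ (sep d⁰) = low ℤ.≤-refl (ℤ.<⇒≤ 0<X) d⁰
    InLd⇒InLd⁰ (mid {a} 1≤a a<Y d) with a ≤? X
    ... | yes a≤X = low (1≤i⇒0≤i 1≤a) a≤X (InLd⇒InLd⁰ d)
    ... | no a≰X  = mid (ℤ.≰⇒> a≰X) a<Y d

    φ-lowTail : ∀ {w} → LowTail w → φ false w ≡ w
    φ-lowTail [0]               = φ-hold false 0<Y
    φ-lowTail (low {a} _ a<X w) =
      trans (φ-hold false (ℤ.<-trans a<X X<Y)) (cong (a ∷_) (φ-lowTail w))

    φ-sep : ∀ b {w} → LowTail w → φ b (0ℤ ∷ w) ≡ carry b ∷ w
    φ-sep b w = trans (φ-hold b (carry<Y b)) (cong (carry b ∷_) (φ-lowTail w))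

    φ-carry-deposit : ∀ {c} → InLa c → Any (X ≤_) (φ true c)
    φ-carry-deposit (sep w) = subst (Any (X ≤_)) (sym (φ-sep true w)) (here ℤ.≤-refl)
    φ-carry-deposit (high {a} 1≤a _ l) with Y ≤? a + X
    ... | yes _ = there (φ-carry-deposit l)
    ... | no _  = here (ℤ.<⇒≤ (X<a+X 1≤a))

    φ-carry-¬LowTail : ∀ {c} → InLa c → ¬ LowTail (φ true c)
    φ-carry-¬LowTail l w = All¬⇒¬Any (All.map ℤ.<⇒≱ (LowTail⇒All<X w)) (φ-carry-deposit l)

    φ-InLd  : ∀ {c} → InLa c → InLd (φ false c)
    φ-InLd⁰ : ∀ {c} → InLa c → InLd⁰ (φ true c)
    φ-InLd (sep w) = subst InLd (sym (φ-sep false w)) (sep (LowTail⇒InLd⁰ w))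
    φ-InLd (high {a} 1≤a a≤Y l) with Y ≤? a
    ... | yes Y≤a rewrite ℤ.≤-antisym a≤Y Y≤a | ℤ.+-inverseʳ Y = sep (φ-InLd⁰ l)
    ... | no Y≰a  = mid 1≤a (ℤ.≰⇒> Y≰a) (φ-InLd l)
    φ-InLd⁰ (sep w) =
      subst InLd⁰ (sym (φ-sep true w)) (low (ℤ.<⇒≤ 0<X) ℤ.≤-refl (LowTail⇒InLd⁰ w))
    φ-InLd⁰ (high {a} 1≤a a≤Y l) with Y ≤? a + X
    ... | yes Y≤a+X = low (ℤ.i≤j⇒0≤j-i Y≤a+X) (i+k-j≤k X a≤Y) (φ-InLd⁰ l)
    ... | no Y≰a+X  = mid (X<a+X 1≤a) (ℤ.≰⇒> Y≰a+X) (φ-InLd l)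

    fire≢hold : ∀ {a a′} b → a ≤ Y → 1ℤ ≤ a′ → a ⊕ b - Y ≢ a′ ⊕ b
    fire≢hold {a} b a≤Y 1≤a′ eq = ℤ.<⇒≱ a-Y<a′ (ℤ.≤-reflexive (sym a-Y≡a′))
      where
      a-Y≡a′ : a - Y ≡ _
      a-Y≡a′ = ⊕-cancelʳ b (trans (sym (⊕-sub a b)) eq)
      a-Y<a′ : a - Y < _
      a-Y<a′ = ℤ.≤-<-trans (ℤ.i≤j⇒i-j≤0 a≤Y) (ℤ.suc[i]≤j⇒i<j {0ℤ} 1≤a′)

    φ-sep≢φ-high : ∀ b {w a r} → LowTail w → 1ℤ ≤ a → InLa r → φ b (0ℤ ∷ w) ≢ φ b (a ∷ r)
    φ-sep≢φ-high b {a = a} w 1≤a l eq with Y ≤? a ⊕ b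
    ... | yes _ = φ-carry-¬LowTail l (subst LowTail (∷-injectiveʳ (trans (sym (φ-sep b w)) eq)) w)
    ... | no _  = ℤ.<⇒≱ (ℤ.suc[i]≤j⇒i<j {0ℤ} 1≤a) (ℤ.≤-reflexive (sym 0≡a))
      where
      0≡a : 0ℤ ≡ a
      0≡a = ⊕-cancelʳ b (∷-injectiveˡ (trans (sym (φ-sep b w)) eq))

    φ-injective : ∀ b {c c′} → InLa c → InLa c′ → φ b c ≡ φ b c′ → c ≡ c′
    φ-injective b (sep w) (sep w′) eq =
      cong (0ℤ ∷_) (∷-injectiveʳ (trans (sym (φ-sep b w)) (trans eq (φ-sep b w′))))
    φ-injective b (sep w) (high 1≤a′ _ l′) eq = ⊥-elim (φ-sep≢φ-high b w 1≤a′ l′ eq)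
    φ-injective b (high 1≤a _ l) (sep w′) eq  = ⊥-elim (φ-sep≢φ-high b w′ 1≤a l (sym eq))
    φ-injective b (high {a} 1≤a a≤Y l) (high {a′} 1≤a′ a′≤Y l′) eq
      with Y ≤? a ⊕ b | Y ≤? a′ ⊕ b
    ... | yes _ | yes _ = cong₂ _∷_ (⊕-cancelʳ b (∙-cancelʳ (- Y) _ _ (∷-injectiveˡ eq)))
                                    (φ-injective true l l′ (∷-injectiveʳ eq))
    ... | no _  | no _  = cong₂ _∷_ (⊕-cancelʳ b (∷-injectiveˡ eq))
                                    (φ-injective false l l′ (∷-injectiveʳ eq))
    ... | yes _ | no _  = ⊥-elim (fire≢hold b a≤Y 1≤a′ (∷-injectiveˡ eq))
    ... | no _  | yes _ = ⊥-elim (fire≢hold b a′≤Y 1≤a (sym (∷-injectiveˡ eq)))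

    φ-fire-Y : ∀ b {r} → φ b (Y ∷ r) ≡ carry b ∷ φ true r
    φ-fire-Y false {r} = trans (φ-fire false ℤ.≤-refl) (cong (_∷ φ true r) (ℤ.+-inverseʳ Y))
    φ-fire-Y true  {r} = trans (φ-fire true (ℤ.i≤i+j Y X)) (cong (_∷ φ true r) (i+j-i≡j Y X))

    φ-fire-low : ∀ {b r} → 0ℤ ≤ b → φ true (b + Y - X ∷ r) ≡ b ∷ φ true r
    φ-fire-low {b} {r} 0≤b = trans (φ-fire true Y≤b+Y-X+X) (cong (_∷ φ true r) b+Y-X+X-Y≡b)
      where
      b+Y-X+X≡b+Y : b + Y - X + X ≡ b + Y
      b+Y-X+X≡b+Y = i-j+j≡i (b + Y) X
      Y≤b+Y-X+X : Y ≤ b + Y - X + X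
      Y≤b+Y-X+X = subst (Y ≤_) (sym b+Y-X+X≡b+Y) (ℤ.+-monoˡ-≤ Y 0≤b)
      b+Y-X+X-Y≡b : b + Y - X + X - Y ≡ b
      b+Y-X+X-Y≡b = trans (cong (_- Y) b+Y-X+X≡b+Y) (i+j-j≡i b Y)

    φ-hold-mid : ∀ {b r} → b < Y → φ true (b - X ∷ r) ≡ b ∷ φ false r
    φ-hold-mid {b} {r} b<Y =
      trans (φ-hold true (subst (_< Y) (sym (i-j+j≡i b X)) b<Y)) (cong (_∷ φ false r) (i-j+j≡i b X))

    φ-surjective       : ∀ {d} → InLd d → Σ Word λ c → InLa c × φ false c ≡ d
    φ-surjective⁰      : ∀ {d} → InLd⁰ d → ¬ LowTail d → Σ Word λ c → InLa c × φ true c ≡ d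
    φ-surjective-carry : ∀ b {r} → InLd⁰ r → Σ Word λ c → InLa c × φ b c ≡ carry b ∷ r

    φ-surjective (sep d⁰) = φ-surjective-carry false d⁰
    φ-surjective (mid {a} 1≤a a<Y d) =
      let (c , l , e) = φ-surjective d
      in a ∷ c , high 1≤a (ℤ.<⇒≤ a<Y) l , trans (φ-hold false a<Y) (cong (a ∷_) e)

    φ-surjective⁰ [0] ¬w = ⊥-elim (¬w [0])
    φ-surjective⁰ (low {b} 0≤b b≤X d⁰) ¬w with ℤ.<-cmp b X
    ... | tri< b<X _ _ =
      let (c , l , e) = φ-surjective⁰ d⁰ (¬w ∘ low 0≤b b<X)
      in b + Y - X ∷ c , high 1≤b+Y-X (i+k-j≤k Y b≤X) l ,
         trans (φ-fire-low 0≤b) (cong (b ∷_) e)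
      where
      1≤b+Y-X : 1ℤ ≤ b + Y - X
      1≤b+Y-X = i<j⇒1≤j-i (ℤ.<-≤-trans X<Y (ℤ.+-monoˡ-≤ Y 0≤b))
    ... | tri≈ _ refl _ = φ-surjective-carry true d⁰
    ... | tri> _ _ X<b  = ⊥-elim (ℤ.≤⇒≯ b≤X X<b)
    φ-surjective⁰ (mid {b} X<b b<Y d) _ =
      let (c , l , e) = φ-surjective d
      in b - X ∷ c , high (i<j⇒1≤j-i X<b) b-X≤Y l , trans (φ-hold-mid b<Y) (cong (b ∷_) e)
      where
      b-X≤Y : b - X ≤ Y
      b-X≤Y = ℤ.≤-trans (ℤ.i-j≤i b X) (ℤ.<⇒≤ b<Y)

    φ-surjective-carry b {r} d⁰ with lowTail? r
    ... | yes w = 0ℤ ∷ r , sep w , φ-sep b w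
    ... | no ¬w =
      let (c , l , e) = φ-surjective⁰ d⁰ ¬w
      in Y ∷ c , high 1≤Y ℤ.≤-refl l , trans (φ-fire-Y b) (cong (carry b ∷_) e)

    LowDigits HighDigits FinalDigits : Word → Set
    LowDigits   = All (λ a → (0ℤ ≤ a) × (a ≤ + (x ℕ.∸ 1)))
    HighDigits  = All (λ a → (1ℤ ≤ a) × (a ≤ Y))
    FinalDigits = All (λ a → (1ℤ ≤ a) × (a ≤ X))

    LowDigits⇒LowTail : ∀ {w} → LowDigits w → LowTail (w ++ 0ℤ ∷ [])
    LowDigits⇒LowTail [] = [0]
    LowDigits⇒LowTail ((0≤a , a≤x-1) ∷ bounds) =
      low 0≤a (≤-pred⇒< 1≤x 0≤a a≤x-1) (LowDigits⇒LowTail bounds)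

    LowTail⇒LowDigits : ∀ {r} → LowTail r →
      Σ Word λ w → (r ≡ w ++ 0ℤ ∷ []) × LowDigits w
    LowTail⇒LowDigits [0] = [] , refl , []
    LowTail⇒LowDigits (low {a} 0≤a a<X w) =
      let (w′ , e , bounds) = LowTail⇒LowDigits w
      in a ∷ w′ , cong (a ∷_) e , (0≤a , <⇒≤-pred 0≤a a<X) ∷ bounds

    La⇒InLa : ∀ {c} → La x y c → InLa c
    La⇒InLa (u , w , refl , highs , lows) = prefix highs
      where
      prefix : ∀ {u} → HighDigits u → InLa (u ++ 0ℤ ∷ w ++ 0ℤ ∷ [])
      prefix []                      = sep (LowDigits⇒LowTail lows)
      prefix ((1≤a , a≤Y) ∷ bounds) = high 1≤a a≤Y (prefix bounds)

    InLa⇒La : ∀ {c} → InLa c → La x y c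
    InLa⇒La (sep w) =
      let (w′ , e , lows) = LowTail⇒LowDigits w
      in [] , w′ , cong (0ℤ ∷_) e , [] , lows
    InLa⇒La (high {a} 1≤a a≤Y l) =
      let (u , w , e , highs , lows) = InLa⇒La l
      in a ∷ u , w , cong (a ∷_) e , (1≤a , a≤Y) ∷ highs , lows

    FinalBlock : Word → Set
    FinalBlock r = Σ Word λ w → (r ≡ w ++ 0ℤ ∷ []) × FinalDigits w

    Ld-∷ : ∀ {a r} → 0ℤ ≤ a → a < Y → Ld x y r → Ld x y (a ∷ r)
    Ld-∷ {a} 0≤a a<Y (u , w , e , prefix , finals) =
      a ∷ u , w , cong (a ∷_) e , (0≤a , <⇒≤-pred 0≤a a<Y) ∷ prefix , finals

    Ld-0∷ : ∀ {r} → FinalBlock r ⊎ Ld x y r → Ld x y (0ℤ ∷ r)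
    Ld-0∷ (inj₁ (w , e , finals)) = [] , w , cong (0ℤ ∷_) e , [] , finals
    Ld-0∷ (inj₂ d)                = Ld-∷ ℤ.≤-refl 0<Y d

    InLd⁰⇒FinalBlock⊎Ld : ∀ {r} → InLd⁰ r → FinalBlock r ⊎ Ld x y r
    InLd⇒Ld : ∀ {d} → InLd d → Ld x y d
    InLd⁰⇒FinalBlock⊎Ld [0] = inj₁ ([] , refl , [])
    InLd⁰⇒FinalBlock⊎Ld (low {a} 0≤a a≤X d⁰)
      with 0≤i⇒i≡0⊎1≤i 0≤a | InLd⁰⇒FinalBlock⊎Ld d⁰
    ... | inj₁ refl | rest                  = inj₂ (Ld-0∷ rest)
    ... | inj₂ 1≤a  | inj₁ (w , e , finals) = inj₁ (a ∷ w , cong (a ∷_) e , (1≤a , a≤X) ∷ finals)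
    ... | inj₂ _    | inj₂ d                = inj₂ (Ld-∷ 0≤a (ℤ.≤-<-trans a≤X X<Y) d)
    InLd⁰⇒FinalBlock⊎Ld (mid X<a a<Y d) =
      inj₂ (Ld-∷ (ℤ.<⇒≤ (ℤ.<-trans 0<X X<a)) a<Y (InLd⇒Ld d))
    InLd⇒Ld (sep d⁰)        = Ld-0∷ (InLd⁰⇒FinalBlock⊎Ld d⁰)
    InLd⇒Ld (mid 1≤a a<Y d) = Ld-∷ (1≤i⇒0≤i 1≤a) a<Y (InLd⇒Ld d)

    Ld⇒InLd : ∀ {d} → Ld x y d → InLd d
    Ld⇒InLd (u , w , refl , prefix , finals) = go prefix
      where
      block : ∀ {w} → FinalDigits w → InLd⁰ (w ++ 0ℤ ∷ [])
      block []                     = [0]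
      block ((1≤a , a≤X) ∷ bounds) = low (1≤i⇒0≤i 1≤a) a≤X (block bounds)
      go : ∀ {u} → All (λ a → (0ℤ ≤ a) × (a ≤ + (y ℕ.∸ 1))) u →
        InLd (u ++ 0ℤ ∷ w ++ 0ℤ ∷ [])
      go [] = sep (block finals)
      go ((0≤a , a≤y-1) ∷ bounds) with 0≤i⇒i≡0⊎1≤i 0≤a
      ... | inj₁ refl = sep (InLd⇒InLd⁰ (go bounds))
      ... | inj₂ 1≤a  = mid 1≤a (≤-pred⇒< 1≤y 0≤a a≤y-1) (go bounds)

  module Weights (n x y : ℕ) where
    d weight : ℕ → ℤ
    d k      = + (x ^ (n ℕ.∸ k) ℕ.* y ^ k)
    weight k = + (x ^ (suc n ℕ.∸ k) ℕ.* y ^ k)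

    weight≡x*d : ∀ {k} → k ℕ.≤ n → weight k ≡ + x * d k
    weight≡x*d {k} k≤n = begin
      + (x ^ (suc n ℕ.∸ k) ℕ.* y ^ k)     ≡⟨ cong (λ e → + (x ^ e ℕ.* y ^ k)) (ℕ.+-∸-assoc 1 k≤n) ⟩
      + (x ℕ.* x ^ (n ℕ.∸ k) ℕ.* y ^ k)   ≡⟨ cong +_ (ℕ.*-assoc x _ _) ⟩
      + (x ℕ.* (x ^ (n ℕ.∸ k) ℕ.* y ^ k)) ≡⟨ ℤ.pos-* x _ ⟩
      + x * d k                            ∎
      where open ≡-Reasoning

    y*weight≡x*weight : ∀ {k} → k ℕ.≤ n → + y * weight k ≡ + x * weight (suc k)
    y*weight≡x*weight {k} k≤n = begin
      + y * weight k                            ≡⟨ cong (+ y *_) (weight≡x*d k≤n) ⟩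
      + y * (+ x * d k)                         ≡⟨ swap (+ y) (+ x) (d k) ⟩
      + x * (+ y * d k)                         ≡⟨ cong (+ x *_) (sym (ℤ.pos-* y _)) ⟩
      + x * + (y ℕ.* (x ^ (n ℕ.∸ k) ℕ.* y ^ k))
        ≡⟨ cong (λ e → + x * + e) (shuffle y (x ^ (n ℕ.∸ k)) (y ^ k)) ⟩
      + x * weight (suc k)                      ∎
      where
      open ≡-Reasoning
      swap : ∀ Y X D → Y * (X * D) ≡ X * (Y * D)
      swap = solve-∀
      shuffle : ∀ y p q → y ℕ.* (p ℕ.* q) ≡ p ℕ.* (y ℕ.* q)
      shuffle = ℕ-solve-∀

    next-position : ∀ {k m} → k ℕ.+ suc m ≡ suc n → suc k ℕ.+ m ≡ suc n
    next-position {k} {m} e = trans (sym (ℕ.+-suc k m)) e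

    position≤n : ∀ {k m} → k ℕ.+ suc m ≡ suc n → k ℕ.≤ n
    position≤n {k} {m} e = ℕ.≤-pred (subst (suc k ℕ.≤_) (next-position e) (ℕ.m≤m+n (suc k) m))

    hE-from : ℕ → Word → ℤ
    hE-from k []      = 0ℤ
    hE-from k (a ∷ u) = a * d k + hE-from (suc k) u

    xhE-from-∷ʳ0 : ∀ k u → k ℕ.+ length u ≡ suc n →
      xhE-from n x y k (u ++ 0ℤ ∷ []) ≡ + x * hE-from k u
    xhE-from-∷ʳ0 k [] _ = zero-last (weight k) (+ x)
      where
      zero-last : ∀ W X → 0ℤ * W + 0ℤ ≡ X * 0ℤ
      zero-last = solve-∀
    xhE-from-∷ʳ0 k (a ∷ u) e = begin
      a * weight k + xhE-from n x y (suc k) (u ++ 0ℤ ∷ [])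
        ≡⟨ cong₂ (λ w h → a * w + h) (weight≡x*d (position≤n e))
                 (xhE-from-∷ʳ0 (suc k) u (next-position e)) ⟩
      a * (+ x * d k) + + x * hE-from (suc k) u
        ≡⟨ factor a (+ x) (d k) (hE-from (suc k) u) ⟩
      + x * hE-from k (a ∷ u) ∎
      where
      open ≡-Reasoning
      factor : ∀ a X D H → a * (X * D) + X * H ≡ X * (a * D + H)
      factor = solve-∀

    hE-from-nonneg : ∀ k {u} → All (0ℤ ≤_) u → 0ℤ ≤ hE-from k u
    hE-from-nonneg k []           = ℤ.≤-refl
    hE-from-nonneg k (0≤a ∷ 0≤us) =
      ℤ.+-mono-≤ (ℤ.*-monoʳ-≤-nonNeg (d k) 0≤a) (hE-from-nonneg (suc k) 0≤us)

    reduced : ℕ → Word → ℤ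
    reduced k []      = 0ℤ
    reduced k (a ∷ w) = a * + (x ^ (suc n ℕ.∸ k)) + + y * reduced (suc k) w

    xhE-from≡y^k*reduced : ∀ k w → xhE-from n x y k w ≡ + (y ^ k) * reduced k w
    xhE-from≡y^k*reduced k []      = sym (ℤ.*-zeroʳ (+ (y ^ k)))
    xhE-from≡y^k*reduced k (a ∷ w) = begin
      a * weight k + xhE-from n x y (suc k) w
        ≡⟨ cong₂ (λ p h → a * p + h) (ℤ.pos-* (x ^ (suc n ℕ.∸ k)) (y ^ k))
                 (xhE-from≡y^k*reduced (suc k) w) ⟩
      a * (P * Q) + + (y ^ suc k) * reduced (suc k) w
        ≡⟨ cong (λ p → a * (P * Q) + p * reduced (suc k) w) (ℤ.pos-* y (y ^ k)) ⟩
      a * (P * Q) + + y * Q * reduced (suc k) w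
        ≡⟨ factor a P Q (+ y) (reduced (suc k) w) ⟩
      Q * reduced k (a ∷ w) ∎
      where
      open ≡-Reasoning
      P Q : ℤ
      P = + (x ^ (suc n ℕ.∸ k))
      Q = + (y ^ k)
      factor : ∀ a P Q Y r → a * (P * Q) + Y * Q * r ≡ Q * (a * P + Y * r)
      factor = solve-∀

    xhE≡reduced0 : ∀ w → xhE n x y w ≡ reduced 0 w
    xhE≡reduced0 w = trans (xhE-from≡y^k*reduced 0 w) (ℤ.*-identityˡ (reduced 0 w))

    reduced-last : ∀ t → reduced (suc n) (t ∷ []) ≡ t
    reduced-last t = trans (cong (λ e → t * + (x ^ e) + + y * 0ℤ) (ℕ.n∸n≡0 n)) (unit t (+ y))
      where
      unit : ∀ t Y → t * 1ℤ + Y * 0ℤ ≡ t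
      unit = solve-∀

    Digit : ℤ → Set
    Digit a = (0ℤ ≤ a) × (a < + y)

    reduced-∷ʳ-injective : Coprime x y → ∀ k {u u′ t t′} →
      k ℕ.+ length u ≡ suc n → length u ≡ length u′ → All Digit u → All Digit u′ →
      reduced k (u ++ t ∷ []) ≡ reduced k (u′ ++ t′ ∷ []) → u ≡ u′ × t ≡ t′
    reduced-∷ʳ-injective _ k {[]} {[]} {t} {t′} e _ _ _ eq = refl , (begin
      t                         ≡⟨ sym (reduced-last t) ⟩
      reduced (suc n) (t ∷ [])  ≡⟨ cong (λ j → reduced j (t ∷ [])) (sym k≡suc-n) ⟩
      reduced k (t ∷ [])        ≡⟨ eq ⟩
      reduced k (t′ ∷ [])       ≡⟨ cong (λ j → reduced j (t′ ∷ [])) k≡suc-n ⟩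
      reduced (suc n) (t′ ∷ []) ≡⟨ reduced-last t′ ⟩
      t′                        ∎)
      where
      open ≡-Reasoning
      k≡suc-n : k ≡ suc n
      k≡suc-n = trans (sym (ℕ.+-identityʳ k)) e
    reduced-∷ʳ-injective coprime k {a ∷ u} {a′ ∷ u′}
      e |u|≡|u′| ((0≤a , a<y) ∷ digits) ((0≤a′ , a′<y) ∷ digits′) eq
      with digit-cancel {m = suc n ℕ.∸ k} coprime 0≤a a<y 0≤a′ a′<y eq
    ... | refl , eq′ =
      let (u≡u′ , t≡t′) = reduced-∷ʳ-injective coprime (suc k) (next-position e)
                            (ℕ.suc-injective |u|≡|u′|) digits digits′ eq′
      in cong (a ∷_) u≡u′ , t≡t′

    stable-unique : ∀ {v v′ w w′} → Coprime x y →
      IsStableDecomposition n x y v w → IsStableDecomposition n x y v′ w′ →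
      xhE n x y w ≡ xhE n x y w′ → w ≡ w′
    stable-unique coprime (_ , _ , u , t , refl , |u| , digits , _)
                          (_ , _ , u′ , t′ , refl , |u′| , digits′ , _) eq =
      let (u≡u′ , t≡t′) = reduced-∷ʳ-injective coprime 0 |u| (trans |u| (sym |u′|))
            digits digits′ (trans (sym (xhE≡reduced0 (u ++ t ∷ []))) (trans eq (xhE≡reduced0 (u′ ++ t′ ∷ []))))
      in cong₂ (λ u t → u ++ t ∷ []) u≡u′ t≡t′

    IsPhi-unique : ∀ {c w w′} → Coprime x y → IsPhi n x y c w → IsPhi n x y c w′ → w ≡ w′
    IsPhi-unique coprime (_ , hc , sd@(_ , hw , _)) (_ , hc′ , sd′@(_ , hw′ , _)) =
      stable-unique coprime sd sd′ (trans hw (trans (sym hc) (trans hc′ (sym hw′))))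

  module Engel (n x y : ℕ) (1≤x : 1 ℕ.≤ x) (x<y : x ℕ.< y) where
    open Carry x y 1≤x x<y
    open Weights n x y

    xhE-from-φ : ∀ b k u → k ℕ.+ length u ≡ suc n →
      xhE-from n x y k (φ b (u ++ 0ℤ ∷ [])) ≡ xhE-from n x y k (u ++ 0ℤ ∷ []) + carry b * weight k
    xhE-from-φ b k [] _ = begin
      xhE-from n x y k (φ b (0ℤ ∷ []))        ≡⟨ cong (xhE-from n x y k) (φ-hold b (carry<Y b)) ⟩
      carry b * weight k + 0ℤ                 ≡⟨ last (carry b) (weight k) ⟩
      0ℤ * weight k + 0ℤ + carry b * weight k ∎
      where
      open ≡-Reasoning
      last : ∀ c W → c * W + 0ℤ ≡ 0ℤ * W + 0ℤ + c * W
      last = solve-∀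
    xhE-from-φ b k (a ∷ u) e with Y ≤? a ⊕ b
    ... | yes _ = begin
      (a ⊕ b - Y) * weight k + xhE-from n x y (suc k) (φ true (u ++ 0ℤ ∷ []))
        ≡⟨ cong₂ (λ s h → (s - Y) * weight k + h) (⊕≡+carry a b)
                 (xhE-from-φ true (suc k) u (next-position e)) ⟩
      (a + carry b - Y) * weight k + (E′ + X * weight (suc k))
        ≡⟨ cong (λ h → (a + carry b - Y) * weight k + (E′ + h))
                (sym (y*weight≡x*weight (position≤n e))) ⟩
      (a + carry b - Y) * weight k + (E′ + Y * weight k)
        ≡⟨ fire a (carry b) Y (weight k) E′ ⟩
      a * weight k + E′ + carry b * weight k ∎
      where
      open ≡-Reasoning
      E′ : ℤ
      E′ = xhE-from n x y (suc k) (u ++ 0ℤ ∷ [])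
      fire : ∀ a c Y W E → (a + c - Y) * W + (E + Y * W) ≡ a * W + E + c * W
      fire = solve-∀
    ... | no _ = begin
      (a ⊕ b) * weight k + xhE-from n x y (suc k) (φ false (u ++ 0ℤ ∷ []))
        ≡⟨ cong₂ (λ s h → s * weight k + h) (⊕≡+carry a b)
                 (xhE-from-φ false (suc k) u (next-position e)) ⟩
      (a + carry b) * weight k + (E′ + 0ℤ * weight (suc k))
        ≡⟨ hold a (carry b) (weight k) (weight (suc k)) E′ ⟩
      a * weight k + E′ + carry b * weight k ∎
      where
      open ≡-Reasoning
      E′ : ℤ
      E′ = xhE-from n x y (suc k) (u ++ 0ℤ ∷ [])
      hold : ∀ a c W W′ E → (a + c) * W + (E + 0ℤ * W′) ≡ a * W + E + c * W
      hold = solve-∀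

    xhE-φ : ∀ {u} → length u ≡ suc n →
      xhE n x y (φ false (u ++ 0ℤ ∷ [])) ≡ xhE n x y (u ++ 0ℤ ∷ [])
    xhE-φ {u} |u| = trans (xhE-from-φ false 0 u |u|) (ℤ.+-identityʳ _)

    ∷ʳ0-regroup : ∀ {c} u w → c ≡ u ++ 0ℤ ∷ w ++ 0ℤ ∷ [] → length c ≡ suc (suc n) →
      (c ≡ (u ++ 0ℤ ∷ w) ++ 0ℤ ∷ []) × (length (u ++ 0ℤ ∷ w) ≡ suc n)
    ∷ʳ0-regroup u w refl |c| = c≡ , ℕ.suc-injective (begin
      suc (length (u ++ 0ℤ ∷ w))           ≡⟨ sym (length-∷ʳ (u ++ 0ℤ ∷ w) 0ℤ) ⟩
      length ((u ++ 0ℤ ∷ w) ++ 0ℤ ∷ [])    ≡⟨ cong length (sym c≡) ⟩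
      length (u ++ 0ℤ ∷ w ++ 0ℤ ∷ [])      ≡⟨ |c| ⟩
      suc (suc n)                          ∎)
      where
      open ≡-Reasoning
      c≡ : u ++ 0ℤ ∷ w ++ 0ℤ ∷ [] ≡ (u ++ 0ℤ ∷ w) ++ 0ℤ ∷ []
      c≡ = sym (++-assoc u (0ℤ ∷ w) (0ℤ ∷ []))

    Lan⇒∷ʳ0 : ∀ {c} → Lan n x y c →
      Σ Word λ u → (c ≡ u ++ 0ℤ ∷ []) × (length u ≡ suc n) × All (0ℤ ≤_) u
    Lan⇒∷ʳ0 ((u , w , e , highs , lows) , |c|) =
      let (c≡ , |p|) = ∷ʳ0-regroup u w e |c|
      in u ++ 0ℤ ∷ w , c≡ , |p| ,
         ++⁺ (All.map (1≤i⇒0≤i ∘ proj₁) highs) (ℤ.≤-refl ∷ All.map proj₁ lows)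

    Ldn⇒∷ʳ0 : ∀ {d} → Ldn n x y d →
      Σ Word λ u → (d ≡ u ++ 0ℤ ∷ []) × (length u ≡ suc n) × All Digit u
    Ldn⇒∷ʳ0 ((u , w , e , prefix , finals) , |d|) =
      let (d≡ , |p|) = ∷ʳ0-regroup u w e |d|
      in u ++ 0ℤ ∷ w , d≡ , |p| ,
         ++⁺ (All.map prefix-digit prefix) ((ℤ.≤-refl , 0<Y) ∷ All.map final-digit finals)
      where
      prefix-digit : ∀ {a} → (0ℤ ≤ a) × (a ≤ + (y ℕ.∸ 1)) → Digit a
      prefix-digit (0≤a , a≤y-1) = 0≤a , ≤-pred⇒< 1≤y 0≤a a≤y-1
      final-digit : ∀ {a} → (1ℤ ≤ a) × (a ≤ X) → Digit a
      final-digit (1≤a , a≤X) = 1≤i⇒0≤i 1≤a , ℤ.≤-<-trans a≤X X<Y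

    φ-Ldn : ∀ {c} → Lan n x y c → Ldn n x y (φ false c)
    φ-Ldn {c} (la , |c|) = InLd⇒Ld (φ-InLd (La⇒InLa la)) , trans (φ-length false c) |c|

    φ-IsPhi : ∀ {c} → Lan n x y c → IsPhi n x y c (φ false c)
    φ-IsPhi lan with Lan⇒∷ʳ0 lan | Ldn⇒∷ʳ0 (φ-Ldn lan)
    ... | u , refl , |u| , nonneg | u′ , d≡ , |u′| , digits =
      hE-from 0 u , hc , hE-from-nonneg 0 nonneg , trans (xhE-φ {u} |u|) hc ,
      u′ , 0ℤ , d≡ , |u′| , digits , x ℕ.∣0
      where
      hc : xhE n x y (u ++ 0ℤ ∷ []) ≡ + x * hE-from 0 u
      hc = xhE-from-∷ʳ0 0 u |u|

    IsPhi⇒≡φ : ∀ {c d} → Coprime x y → Lan n x y c → IsPhi n x y c d → d ≡ φ false c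
    IsPhi⇒≡φ {c} coprime lan i = IsPhi-unique {c} coprime i (φ-IsPhi lan)

    IsPhi⇒Ldn : ∀ {c d} → Coprime x y → Lan n x y c → IsPhi n x y c d → Ldn n x y d
    IsPhi⇒Ldn coprime lan i = subst (Ldn n x y) (sym (IsPhi⇒≡φ coprime lan i)) (φ-Ldn lan)

    IsPhi-injective : ∀ {c c′ d} → Coprime x y → Lan n x y c → Lan n x y c′ →
      IsPhi n x y c d → IsPhi n x y c′ d → c ≡ c′
    IsPhi-injective coprime lan@(la , _) lan′@(la′ , _) i i′ =
      φ-injective false (La⇒InLa la) (La⇒InLa la′)
        (trans (sym (IsPhi⇒≡φ coprime lan i)) (IsPhi⇒≡φ coprime lan′ i′))

    IsPhi-onto : ∀ {d} → Ldn n x y d → Σ Word λ c → Lan n x y c × IsPhi n x y c d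
    IsPhi-onto (ld , |d|) =
      let (c , l , e) = φ-surjective (Ld⇒InLd ld)
          lan = InLa⇒La l , trans (sym (φ-length false c)) (trans (cong length e) |d|)
      in c , lan , subst (IsPhi n x y c) e (φ-IsPhi lan)

open import Data.Bool using (false)
open import Data.Nat using (ℕ; _≤_; _<_)
open import Data.Nat.Coprimality using (Coprime)
open import Data.Product using (Σ; _×_; _,_)
open import Relation.Binary.PropositionalEquality using (_≡_; sym; trans)

lemma6 : (n x y : ℕ) → 1 ≤ n → 1 ≤ x → x < y → Coprime x y →
    -- φ is well defined on L^n_a: the stable decomposition of h_E(c) exists and is unique
    ((c : Word) → Lan n x y c → Σ Word λ d → IsPhi n x y c d) ×
    ((c d d′ : Word) → Lan n x y c → IsPhi n x y c d → IsPhi n x y c d′ → d ≡ d′) ×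
    -- φ maps L^n_a into L^n_d
    ((c d : Word) → Lan n x y c → IsPhi n x y c d → Ldn n x y d) ×
    -- φ is injective on L^n_a
    ((c c′ d : Word) → Lan n x y c → Lan n x y c′ →
      IsPhi n x y c d → IsPhi n x y c′ d → c ≡ c′) ×
    -- φ is onto L^n_d
    ((d : Word) → Ldn n x y d → Σ Word λ c → Lan n x y c × IsPhi n x y c d) ×
    -- h_E(φ(c)) = h_E(c)
    ((c d : Word) → Lan n x y c → IsPhi n x y c d → xhE n x y d ≡ xhE n x y c)
lemma6 n x y _ 1≤x x<y coprime =
    (λ c lan → φ false c , φ-IsPhi lan)
  , (λ c _ _ _ → IsPhi-unique {c} coprime)
  , (λ _ _ → IsPhi⇒Ldn coprime)
  , (λ _ _ _ → IsPhi-injective coprime)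
  , (λ _ → IsPhi-onto)
  , (λ _ _ _ (_ , hc , _ , hd , _) → trans hd (sym hc))
  where
  open Stabilisation.Carry x y 1≤x x<y
  open Stabilisation.Weights n x y
  open Stabilisation.Engel n x y 1≤x x<y
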